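{- Let $G_0,G_1\in\mathbb{Z}$ with $\gcd(G_0,G_1)=1$, and let $(G_n)_{n\ge0}$ satisfy $G_n=G_{n-1}+G_{n-2}$ for $n\ge2$. For every integer $i\ge0$, the value $\gcd(G_i+G_{i+2},\,G_{i+1}+G_{i+3})$ is either $1$ or $5$. -}

module Defs where

-- Write a = G i and b = G (i+1). Then G i + G (i+2) = 2a + b and G (i+1) + G (i+3) = a + 3b,
-- a linear image of (a, b) under a matrix of determinant 5. Any common divisor d of the two
-- values therefore divides 5a and 5b, hence divides 5 gcd(a, b). Consecutive terms are coprime
-- because (G i, G (i+1)) and (G (i+1), G (i+2)) have the same common divisors, so d ∣ 5.
module Submission where

open import Defs
open import Data.Nat using (ℕ; suc)
open import Data.Integer using (ℤ; _+_; +_)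
open import Data.Integer.GCD using (gcd)
open import Data.Sum using (_⊎_)
open import Relation.Binary.PropositionalEquality using (_≡_)

open import Data.Product using (_×_; _,_; uncurry)
open import Data.Sum using (map)
open import Data.Integer using (_*_; _-_)
import Data.Integer as ℤ using (∣_∣)
open import Data.Integer.Properties using (abs-*)
open import Data.Integer.Divisibility.Signed
  using (_∣_; ∣ᵤ⇒∣; ∣⇒∣ᵤ; ∣m∣n⇒∣m-n; ∣n⇒∣m*n; ∣m+n∣m⇒∣n)
open import Data.Integer.GCD using (gcd-greatest; gcd[i,j]∣i; gcd[i,j]∣j)
open import Data.Integer.Tactic.RingSolver using (solve-∀)
import Data.Nat as ℕ
import Data.Nat.Divisibility as ℕ
import Data.Nat.GCD as ℕ
import Data.Nat.Properties as ℕ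
open import Data.Nat.Primality using (Irreducible; irreducible?)
open import Relation.Binary.PropositionalEquality using (cong; cong₂; subst; module ≡-Reasoning)
open import Relation.Nullary.Decidable using (from-yes)

irreducible[5] : Irreducible 5
irreducible[5] = from-yes (irreducible? 5)

gcd∣5⇒gcd≡1⊎gcd≡5 : ∀ i j → gcd i j ∣ + 5 → gcd i j ≡ + 1 ⊎ gcd i j ≡ + 5
gcd∣5⇒gcd≡1⊎gcd≡5 i j g∣5 = map (cong (+_)) (cong (+_)) (irreducible[5] (∣⇒∣ᵤ g∣5))

gcd≡1⇒∣1 : ∀ {i j k} → gcd i j ≡ + 1 → k ∣ i → k ∣ j → k ∣ + 1
gcd≡1⇒∣1 {i} {j} {k} gcd≡1 k∣i k∣j =
  ∣ᵤ⇒∣ (subst (ℤ.∣ k ∣ ℕ.∣_) (cong ℤ.∣_∣ gcd≡1) (gcd-greatest {i} {j} {k} (∣⇒∣ᵤ k∣i) (∣⇒∣ᵤ k∣j)))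

∣1⇒gcd≡1 : ∀ i j → (∀ {k} → k ∣ i → k ∣ j → k ∣ + 1) → gcd i j ≡ + 1
∣1⇒gcd≡1 i j common∣1 =
  cong (+_) (ℕ.∣1⇒≡1 (∣⇒∣ᵤ (common∣1 {gcd i j} (∣ᵤ⇒∣ (gcd[i,j]∣i i j)) (∣ᵤ⇒∣ (gcd[i,j]∣j i j)))))

gcd≡1⇒∣k*i⇒∣k*j⇒∣k : ∀ {d i j} k → gcd i j ≡ + 1 → d ∣ k * i → d ∣ k * j → d ∣ k
gcd≡1⇒∣k*i⇒∣k*j⇒∣k {d} {i} {j} k gcd≡1 d∣ki d∣kj = ∣ᵤ⇒∣ (begin
  ℤ.∣ d ∣                                          ∣⟨ ℕ.gcd-greatest (∣⇒∣ᵤ d∣ki) (∣⇒∣ᵤ d∣kj) ⟩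
  ℕ.gcd ℤ.∣ k * i ∣ ℤ.∣ k * j ∣                    ≡⟨ cong₂ ℕ.gcd (abs-* k i) (abs-* k j) ⟩
  ℕ.gcd (ℤ.∣ k ∣ ℕ.* ℤ.∣ i ∣) (ℤ.∣ k ∣ ℕ.* ℤ.∣ j ∣) ≡⟨ ℕ.c*gcd[m,n]≡gcd[cm,cn] ℤ.∣ k ∣ ℤ.∣ i ∣ ℤ.∣ j ∣ ⟨
  ℤ.∣ k ∣ ℕ.* ℕ.gcd ℤ.∣ i ∣ ℤ.∣ j ∣                ≡⟨ cong (ℤ.∣ k ∣ ℕ.*_) (cong ℤ.∣_∣ gcd≡1) ⟩
  ℤ.∣ k ∣ ℕ.* 1                                    ≡⟨ ℕ.*-identityʳ ℤ.∣ k ∣ ⟩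
  ℤ.∣ k ∣                                          ∎)
  where open ℕ.∣-Reasoning

∣-linear⇒∣det* : ∀ {d} p q r s i j → d ∣ p * i + q * j → d ∣ r * i + s * j →
                 d ∣ (p * s - q * r) * i × d ∣ (p * s - q * r) * j
∣-linear⇒∣det* {d} p q r s i j d∣x d∣y =
    subst (d ∣_) (eliminate-j p q r s i j) (∣m∣n⇒∣m-n (∣n⇒∣m*n s d∣x) (∣n⇒∣m*n q d∣y))
  , subst (d ∣_) (eliminate-i p q r s i j) (∣m∣n⇒∣m-n (∣n⇒∣m*n p d∣y) (∣n⇒∣m*n r d∣x))
  where
  eliminate-j : ∀ p q r s i j → s * (p * i + q * j) - q * (r * i + s * j) ≡ (p * s - q * r) * i
  eliminate-j = solve-∀
  eliminate-i : ∀ p q r s i j → p * (r * i + s * j) - r * (p * i + q * j) ≡ (p * s - q * r) * j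
  eliminate-i = solve-∀

gcd-linear∣det : ∀ p q r s i j → gcd i j ≡ + 1 →
                 gcd (p * i + q * j) (r * i + s * j) ∣ p * s - q * r
gcd-linear∣det p q r s i j gcd≡1 =
  uncurry (gcd≡1⇒∣k*i⇒∣k*j⇒∣k (p * s - q * r) gcd≡1)
          (∣-linear⇒∣det* p q r s i j (∣ᵤ⇒∣ (gcd[i,j]∣i x y)) (∣ᵤ⇒∣ (gcd[i,j]∣j x y)))
  where
  x = p * i + q * j
  y = r * i + s * j

module FibonacciLike (G : ℕ → ℤ) (recurrence : ∀ n → G (suc (suc n)) ≡ G (suc n) + G n) where

  consecutive-coprime : gcd (G 0) (G 1) ≡ + 1 → ∀ i → gcd (G i) (G (suc i)) ≡ + 1
  consecutive-coprime gcd≡1 i = ∣1⇒gcd≡1 (G i) (G (suc i)) (common∣1 i)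
    where
    common∣1 : ∀ i {k} → k ∣ G i → k ∣ G (suc i) → k ∣ + 1
    common∣1 0       = gcd≡1⇒∣1 gcd≡1
    common∣1 (suc i) k∣Gi+1 k∣Gi+2 =
      common∣1 i (∣m+n∣m⇒∣n (subst (_ ∣_) (recurrence i) k∣Gi+2) k∣Gi+1) k∣Gi+1

  G[i]+G[i+2] : ∀ i → G i + G (suc (suc i)) ≡ + 2 * G i + + 1 * G (suc i)
  G[i]+G[i+2] i = begin
    G i + G (suc (suc i))       ≡⟨ cong (_+_ (G i)) (recurrence i) ⟩
    G i + (G (suc i) + G i)     ≡⟨ normalise (G i) (G (suc i)) ⟩
    + 2 * G i + + 1 * G (suc i) ∎
    where
    open ≡-Reasoning
    normalise : ∀ a b → a + (b + a) ≡ + 2 * a + + 1 * b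
    normalise = solve-∀

  G[i+1]+G[i+3] : ∀ i → G (suc i) + G (suc (suc (suc i))) ≡ + 1 * G i + + 3 * G (suc i)
  G[i+1]+G[i+3] i = begin
    G (suc i) + G (suc (suc (suc i)))           ≡⟨ cong (_+_ (G (suc i))) (recurrence (suc i)) ⟩
    G (suc i) + (G (suc (suc i)) + G (suc i))   ≡⟨ cong (λ x → G (suc i) + (x + G (suc i))) (recurrence i) ⟩
    G (suc i) + ((G (suc i) + G i) + G (suc i)) ≡⟨ normalise (G i) (G (suc i)) ⟩
    + 1 * G i + + 3 * G (suc i)                 ∎
    where
    open ≡-Reasoning
    normalise : ∀ a b → b + ((b + a) + b) ≡ + 1 * a + + 3 * b
    normalise = solve-∀

lemma4p2 : (G : ℕ → ℤ) → gcd (G 0) (G 1) ≡ + 1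
    → (∀ n → G (suc (suc n)) ≡ G (suc n) + G n)
    → ∀ i → (gcd (G i + G (suc (suc i))) (G (suc i) + G (suc (suc (suc i)))) ≡ + 1)
            ⊎ (gcd (G i + G (suc (suc i))) (G (suc i) + G (suc (suc (suc i)))) ≡ + 5)
lemma4p2 G gcd≡1 recurrence i
  rewrite FibonacciLike.G[i]+G[i+2] G recurrence i
        | FibonacciLike.G[i+1]+G[i+3] G recurrence i =
  gcd∣5⇒gcd≡1⊎gcd≡5 (+ 2 * G i + + 1 * G (suc i)) (+ 1 * G i + + 3 * G (suc i))
    (gcd-linear∣det (+ 2) (+ 1) (+ 1) (+ 3) (G i) (G (suc i)) G[i]⊥G[i+1])
  where
  G[i]⊥G[i+1] : gcd (G i) (G (suc i)) ≡ + 1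
  G[i]⊥G[i+1] = FibonacciLike.consecutive-coprime G recurrence gcd≡1 i
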